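{- Let $\mathbf{B}$ be a topological Boolean algebra, $\nabla$ an open filter and $\Delta$ a closed ideal of $\mathbf{B}$, and $\mathbf{T}=Tw(\mathbf{B},\nabla,\Delta)$. Suppose that $\mathbf{B}\models\mathsf{Grz}$ and $\mathsf{G}(\mathbf{B})=\Lambda(\mathbf{B},\nabla)$. Then $(\Box a,\Box b)\in\mathbf{T}$ for all $(a,b)\in\mathbf{T}$.
   Context: A topological Boolean algebra (TBA) is an algebra $\mathbf{B}=\langle B;\vee,\wedge,\to,\bot,\Box\rangle$ whose reduct is a Boolean algebra (top $1$, $\neg a:=a\to\bot$) with $\Box 1=1$, $\Box(a\wedge b)=\Box a\wedge\Box b$, $\Box a\le a$, $\Box a\le\Box\Box a$; $\Diamond a:=\neg\Box\neg a$. $\mathsf{G}(\mathbf{B})=\{a\in B:\Box a=a\}$. A filter is open if closed under $\Box$; an ideal is closed if closed under $\Diamond$. $Tw(\mathbf{B},\nabla,\Delta)=\{(a,b)\in B\times B:a\vee b\in\nabla,\ a\wedge b\in\Delta\}$. $\Lambda(\mathbf{B},\nabla)=\{a\in\mathsf{G}(\mathbf{B}):a\vee\Box\neg a\in\nabla\}$. $\mathsf{S4}$ is the least set of formulas in $\wedge,\vee,\to,\bot,\Box$ containing the classical tautology axioms, $\Box(p\to p)$, $(\Box p\wedge\Box q)\to\Box(p\wedge q)$, $\Box p\to p$, $\Box p\to\Box\Box p$, closed under substitution, modus ponens and from $\varphi\to\psi$ infer $\Box\varphi\to\Box\psi$; $\mathsf{Grz}$ is the least such set containing $\mathsf{S4}$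 and $\Box(\Box(p\to\Box p)\to p)\to p$. $\mathbf{B}\models\mathsf{Grz}$ means $v(\varphi)=1$ for every $\varphi\in\mathsf{Grz}$ and every homomorphism $v$ from the formula algebra into $\mathbf{B}$. -}

module Defs where

open import Level using (Level; _⊔_; suc)
open import Data.Nat using (ℕ)
open import Data.Bool using (Bool; true; false; not) renaming (_∧_ to _&&_; _∨_ to _||_)
open import Data.Product using (_×_; _,_)
open import Relation.Binary.PropositionalEquality using (_≡_)
open import Algebra.Lattice.Bundles using (BooleanAlgebra)

record TBA (c ℓ : Level) : Set (suc (c ⊔ ℓ)) where
  field
    BA : BooleanAlgebra c ℓ
  open BooleanAlgebra BA public
  infix 4 _≤_
  _≤_ : Carrier → Carrier → Set ℓ
  a ≤ b = (a ∧ b) ≈ a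
  _⇒_ : Carrier → Carrier → Carrier
  a ⇒ b = (¬ a) ∨ b
  field
    □       : Carrier → Carrier
    □-cong  : ∀ {a b} → a ≈ b → □ a ≈ □ b
    □-top   : □ ⊤ ≈ ⊤
    □-∧     : ∀ a b → □ (a ∧ b) ≈ (□ a ∧ □ b)
    □-defl  : ∀ a → □ a ≤ a
    □-4     : ∀ a → □ a ≤ □ (□ a)
  ◇ : Carrier → Carrier
  ◇ a = ¬ (□ (¬ a))

module _ {c ℓ : Level} (B : TBA c ℓ) where
  open TBA B


  IsOpenElt : Carrier → Set ℓ
  IsOpenElt a = □ a ≈ a

  record IsFilter {ℓ'} (F : Carrier → Set ℓ') : Set (c ⊔ ℓ ⊔ ℓ') where
    field
      top   : F ⊤
      meet  : ∀ {a b} → F a → F b → F (a ∧ b)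
      upper : ∀ {a b} → F a → a ≤ b → F b

  record IsOpenFilter {ℓ'} (F : Carrier → Set ℓ') : Set (c ⊔ ℓ ⊔ ℓ') where
    field
      isFilter : IsFilter F
      box      : ∀ {a} → F a → F (□ a)

  record IsIdeal {ℓ'} (I : Carrier → Set ℓ') : Set (c ⊔ ℓ ⊔ ℓ') where
    field
      bot   : I ⊥
      join  : ∀ {a b} → I a → I b → I (a ∨ b)
      lower : ∀ {a b} → I b → a ≤ b → I a

  record IsClosedIdeal {ℓ'} (I : Carrier → Set ℓ') : Set (c ⊔ ℓ ⊔ ℓ') where
    field
      isIdeal : IsIdeal I
      dia     : ∀ {a} → I a → I (◇ a)

  InTw : ∀ {ℓ₁ ℓ₂} → (Carrier → Set ℓ₁) → (Carrier → Set ℓ₂) → Carrier → Carrier → Set (ℓ₁ ⊔ ℓ₂)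
  InTw ∇ Δ a b = ∇ (a ∨ b) × Δ (a ∧ b)

  InΛ : ∀ {ℓ₁} → (Carrier → Set ℓ₁) → Carrier → Set (ℓ ⊔ ℓ₁)
  InΛ ∇ a = IsOpenElt a × ∇ (a ∨ □ (¬ a))

infixr 6 _⋀_
infixr 5 _⋁_
infixr 4 _⟶_

data Fm : Set where
  var  : ℕ → Fm
  _⋀_  : Fm → Fm → Fm
  _⋁_  : Fm → Fm → Fm
  _⟶_  : Fm → Fm → Fm
  ⊥f   : Fm
  ■    : Fm → Fm

evalC : (Fm → Bool) → Fm → Bool
evalC ρ (var n)  = ρ (var n)
evalC ρ (φ ⋀ ψ)  = evalC ρ φ && evalC ρ ψ
evalC ρ (φ ⋁ ψ)  = evalC ρ φ || evalC ρ ψ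
evalC ρ (φ ⟶ ψ) = not (evalC ρ φ) || evalC ρ ψ
evalC ρ ⊥f       = false
evalC ρ (■ φ)    = ρ (■ φ)

-- Substitution instances of classical propositional tautologies.
Tautology : Fm → Set
Tautology φ = ∀ ρ → evalC ρ φ ≡ true

-- Grz as a Hilbert system (axiom schemes = substitution-closed axioms).
data ⊢Grz : Fm → Set where
  taut : ∀ {φ} → Tautology φ → ⊢Grz φ
  ax-N : ∀ φ → ⊢Grz (■ (φ ⟶ φ))
  ax-C : ∀ φ ψ → ⊢Grz ((■ φ ⋀ ■ ψ) ⟶ ■ (φ ⋀ ψ))
  ax-T : ∀ φ → ⊢Grz (■ φ ⟶ φ)
  ax-4 : ∀ φ → ⊢Grz (■ φ ⟶ ■ (■ φ))
  ax-Grz : ∀ φ → ⊢Grz (■ (■ (φ ⟶ ■ φ) ⟶ φ) ⟶ φ)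
  mp   : ∀ {φ ψ} → ⊢Grz (φ ⟶ ψ) → ⊢Grz φ → ⊢Grz ψ
  mono : ∀ {φ ψ} → ⊢Grz (φ ⟶ ψ) → ⊢Grz (■ φ ⟶ ■ ψ)

module _ {c ℓ : Level} (B : TBA c ℓ) where
  open TBA B

  ⟦_⟧ : Fm → (ℕ → Carrier) → Carrier
  ⟦ var n ⟧ v   = v n
  ⟦ φ ⋀ ψ ⟧ v   = ⟦ φ ⟧ v ∧ ⟦ ψ ⟧ v
  ⟦ φ ⋁ ψ ⟧ v   = ⟦ φ ⟧ v ∨ ⟦ ψ ⟧ v
  ⟦ φ ⟶ ψ ⟧ v  = ⟦ φ ⟧ v ⇒ ⟦ ψ ⟧ v
  ⟦ ⊥f ⟧ v      = ⊥
  ⟦ ■ φ ⟧ v     = □ (⟦ φ ⟧ v)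

  ModelsGrz : Set (c ⊔ ℓ)
  ModelsGrz = ∀ φ → ⊢Grz φ → ∀ (v : ℕ → Carrier) → ⟦ φ ⟧ v ≈ ⊤

-- The Δ-part is immediate from □a ∧ □b ≤ a ∧ b. For the ∇-part, □(a ∨ b) ∈ ∇ as ∇ is
-- open, and since □a, □b are open they lie in Λ, so □a ∨ □¬□a and □b ∨ □¬□b lie in ∇.
-- Their meet is below □a ∨ □b because □((a ∨ b) ∧ ¬□a ∧ ¬□b) = ⊥ in any Grz-algebra:
-- an open k ≤ a ∨ b disjoint from □a and □b is disjoint from □¬a (as k ∧ ¬a ≤ b), and
-- the Grz axiom, applied to ¬a, makes an open element disjoint from □a and □¬a
-- disjoint from a; symmetrically k is disjoint from b, so k = ⊥.
module Submission where

open import Defs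
open import Level using (Level)
open import Data.Product using (_,_; proj₁; proj₂)
open import Relation.Binary.Bundles using (Poset)
open import Algebra.Lattice.Bundles using (BooleanAlgebra)
import Algebra.Lattice.Properties.Lattice as LatticeProperties
import Algebra.Lattice.Properties.BooleanAlgebra as BooleanAlgebraProperties
import Relation.Binary.Lattice.Structures as OrderLattice
import Relation.Binary.Reasoning.PartialOrder as PartialOrderReasoning

module BooleanAlgebraOrder {c ℓ : Level} (BA : BooleanAlgebra c ℓ) where
  open BooleanAlgebra BA
  open BooleanAlgebraProperties BA using (∧-identityʳ)
  open LatticeProperties lattice using (poset; ∨-∧-isOrderTheoreticLattice)

  infix 4 _≤_
  _≤_ : Carrier → Carrier → Set ℓ
  x ≤ y = (x ∧ y) ≈ x

  -- The library orders a lattice by x ≈ x ∧ y; ours (that of TBA) is its mirror image.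
  private
    module Natural = Poset poset
    module NaturalLattice = OrderLattice.IsLattice ∨-∧-isOrderTheoreticLattice

  ≤-poset : Poset c ℓ ℓ
  ≤-poset = record
    { _≤_            = _≤_
    ; isPartialOrder = record
      { isPreorder = record
        { isEquivalence = isEquivalence
        ; reflexive     = λ x≈y → sym (Natural.reflexive x≈y)
        ; trans         = λ x≤y y≤z → sym (Natural.trans (sym x≤y) (sym y≤z))
        }
      ; antisym    = λ x≤y y≤x → Natural.antisym (sym x≤y) (sym y≤x)
      }
    }

  open Poset ≤-poset public using ()
    renaming (refl to ≤-refl; reflexive to ≤-reflexive; trans to ≤-trans; antisym to ≤-antisym)
  module ≤-Reasoning = PartialOrderReasoning ≤-poset

  x∧y≤x : ∀ {x y} → x ∧ y ≤ x
  x∧y≤x {x} {y} = sym (proj₁ (NaturalLattice.infimum x y))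

  x∧y≤y : ∀ {x y} → x ∧ y ≤ y
  x∧y≤y {x} {y} = sym (proj₁ (proj₂ (NaturalLattice.infimum x y)))

  ∧-greatest : ∀ {x y z} → z ≤ x → z ≤ y → z ≤ x ∧ y
  ∧-greatest {x} {y} {z} z≤x z≤y =
    sym (proj₂ (proj₂ (NaturalLattice.infimum x y)) z (sym z≤x) (sym z≤y))

  x≤x∨y : ∀ {x y} → x ≤ x ∨ y
  x≤x∨y {x} {y} = sym (proj₁ (NaturalLattice.supremum x y))

  y≤x∨y : ∀ {x y} → y ≤ x ∨ y
  y≤x∨y {x} {y} = sym (proj₁ (proj₂ (NaturalLattice.supremum x y)))

  ∨-least : ∀ {x y z} → x ≤ z → y ≤ z → x ∨ y ≤ z
  ∨-least {x} {y} {z} x≤z y≤z =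
    sym (proj₂ (proj₂ (NaturalLattice.supremum x y)) z (sym x≤z) (sym y≤z))

  ∧-mono-≤ : ∀ {x y u v} → x ≤ u → y ≤ v → x ∧ y ≤ u ∧ v
  ∧-mono-≤ x≤u y≤v = ∧-greatest (≤-trans x∧y≤x x≤u) (≤-trans x∧y≤y y≤v)

  ⊥-minimum : ∀ {x} → ⊥ ≤ x
  ⊥-minimum {x} = ≤-trans (≤-reflexive (sym (∧-complementʳ x))) x∧y≤x

  x∧z≤⊥⇒x∧[y∨z]≤y : ∀ {x y z} → x ∧ z ≤ ⊥ → x ∧ (y ∨ z) ≤ y
  x∧z≤⊥⇒x∧[y∨z]≤y {x} {y} {z} x∧z≤⊥ = begin
    x ∧ (y ∨ z)        ≈⟨ ∧-distribˡ-∨ x y z ⟩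
    x ∧ y ∨ x ∧ z      ≤⟨ ∨-least x∧y≤y (≤-trans x∧z≤⊥ ⊥-minimum) ⟩
    y                  ∎
    where open ≤-Reasoning

  [x∨y]∧¬x≤y : ∀ {x y} → (x ∨ y) ∧ ¬ x ≤ y
  [x∨y]∧¬x≤y {x} {y} = begin
    (x ∨ y) ∧ ¬ x      ≈⟨ ∧-comm (x ∨ y) (¬ x) ⟩
    ¬ x ∧ (x ∨ y)      ≈⟨ ∧-congˡ (∨-comm x y) ⟩
    ¬ x ∧ (y ∨ x)      ≤⟨ x∧z≤⊥⇒x∧[y∨z]≤y (≤-reflexive (∧-complementˡ x)) ⟩
    y                  ∎
    where open ≤-Reasoning

  x≤y∨z⇒x∧¬y≤z : ∀ {x y z} → x ≤ y ∨ z → x ∧ ¬ y ≤ z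
  x≤y∨z⇒x∧¬y≤z x≤y∨z = ≤-trans (∧-mono-≤ x≤y∨z ≤-refl) [x∨y]∧¬x≤y

  x∧y≤z⇒x≤¬y∨z : ∀ {x y z} → x ∧ y ≤ z → x ≤ ¬ y ∨ z
  x∧y≤z⇒x≤¬y∨z {x} {y} {z} x∧y≤z = begin
    x                  ≈⟨ ∧-identityʳ x ⟨
    x ∧ ⊤              ≈⟨ ∧-congˡ (∨-complementʳ y) ⟨
    x ∧ (y ∨ ¬ y)      ≈⟨ ∧-distribˡ-∨ x y (¬ y) ⟩
    x ∧ y ∨ x ∧ ¬ y    ≤⟨ ∨-least (≤-trans x∧y≤z y≤x∨y) (≤-trans x∧y≤y x≤x∨y) ⟩
    ¬ y ∨ z            ∎
    where open ≤-Reasoning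

  x∧¬y≤⊥⇒x≤y : ∀ {x y} → x ∧ ¬ y ≤ ⊥ → x ≤ y
  x∧¬y≤⊥⇒x≤y {x} {y} x∧¬y≤⊥ = begin
    x                  ≈⟨ ∧-identityʳ x ⟨
    x ∧ ⊤              ≈⟨ ∧-congˡ (∨-complementʳ y) ⟨
    x ∧ (y ∨ ¬ y)      ≤⟨ x∧z≤⊥⇒x∧[y∨z]≤y x∧¬y≤⊥ ⟩
    y                  ∎
    where open ≤-Reasoning

  ¬x∨y≈⊤⇒x≤y : ∀ {x y} → ¬ x ∨ y ≈ ⊤ → x ≤ y
  ¬x∨y≈⊤⇒x≤y {x} {y} ¬x∨y≈⊤ = begin
    x                  ≈⟨ ∧-identityʳ x ⟨
    x ∧ ⊤              ≈⟨ ∧-congˡ (trans (∨-comm y (¬ x)) ¬x∨y≈⊤) ⟨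
    x ∧ (y ∨ ¬ x)      ≤⟨ x∧z≤⊥⇒x∧[y∨z]≤y (≤-reflexive (∧-complementʳ x)) ⟩
    y                  ∎
    where open ≤-Reasoning

module TopologicalBooleanAlgebraProperties {c ℓ : Level} (B : TBA c ℓ) where
  open TBA B hiding (_≤_)
  open BooleanAlgebraOrder BA
  open BooleanAlgebraProperties BA using (¬-involutive; deMorgan₂)

  □-mono : ∀ {x y} → x ≤ y → □ x ≤ □ y
  □-mono {x} {y} x≤y = trans (sym (□-∧ x y)) (□-cong x≤y)

  □-idem : ∀ x → IsOpenElt B (□ x)
  □-idem x = ≤-antisym (□-defl (□ x)) (□-4 x)

  open-∧-□-mono : ∀ {k x y} → IsOpenElt B k → k ∧ x ≤ y → k ∧ □ x ≤ □ y
  open-∧-□-mono {k} {x} {y} k-open k∧x≤y = begin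
    k ∧ □ x            ≈⟨ ∧-congʳ k-open ⟨
    □ k ∧ □ x          ≈⟨ □-∧ k x ⟨
    □ (k ∧ x)          ≤⟨ □-mono k∧x≤y ⟩
    □ y                ∎
    where open ≤-Reasoning

  module Grzegorczyk (grz : ModelsGrz B) where

    grz-axiom : ∀ p → □ (□ (p ⇒ □ p) ⇒ p) ≤ p
    grz-axiom p = ¬x∨y≈⊤⇒x≤y (grz _ (ax-Grz (var 0)) (λ _ → p))

    grz-rule : ∀ {k p} → IsOpenElt B k → k ∧ □ (p ⇒ □ p) ≤ p → k ≤ p
    grz-rule {k} {p} k-open k∧□[p⇒□p]≤p = begin
      k                       ≈⟨ k-open ⟨
      □ k                     ≤⟨ □-mono (x∧y≤z⇒x≤¬y∨z k∧□[p⇒□p]≤p) ⟩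
      □ (□ (p ⇒ □ p) ⇒ p)     ≤⟨ grz-axiom p ⟩
      p                       ∎
      where open ≤-Reasoning

    open-disjoint-□-□¬⇒disjoint : ∀ {k a} → IsOpenElt B k →
      k ∧ □ a ≤ ⊥ → k ∧ □ (¬ a) ≤ ⊥ → k ∧ a ≤ ⊥
    open-disjoint-□-□¬⇒disjoint {k} {a} k-open k∧□a≤⊥ k∧□¬a≤⊥ =
      ≤-trans (∧-mono-≤ k≤¬a ≤-refl) (≤-reflexive (∧-complementˡ a))
      where
      k∧[¬¬a∨□¬a]≤a : k ∧ (¬ ¬ a ∨ □ (¬ a)) ≤ a
      k∧[¬¬a∨□¬a]≤a = ≤-trans (x∧z≤⊥⇒x∧[y∨z]≤y k∧□¬a≤⊥) (≤-reflexive (¬-involutive a))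

      k∧□[¬¬a∨□¬a]≤⊥ : k ∧ □ (¬ ¬ a ∨ □ (¬ a)) ≤ ⊥
      k∧□[¬¬a∨□¬a]≤⊥ =
        ≤-trans (∧-greatest x∧y≤x (open-∧-□-mono k-open k∧[¬¬a∨□¬a]≤a)) k∧□a≤⊥

      k≤¬a : k ≤ ¬ a
      k≤¬a = grz-rule k-open (≤-trans k∧□[¬¬a∨□¬a]≤⊥ ⊥-minimum)

    open-≤-∨-disjoint-□⇒disjoint : ∀ {k a b} → IsOpenElt B k → k ≤ a ∨ b →
      k ∧ □ a ≤ ⊥ → k ∧ □ b ≤ ⊥ → k ∧ a ≤ ⊥
    open-≤-∨-disjoint-□⇒disjoint {k} {a} {b} k-open k≤a∨b k∧□a≤⊥ k∧□b≤⊥ =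
      open-disjoint-□-□¬⇒disjoint k-open k∧□a≤⊥ k∧□¬a≤⊥
      where
      k∧□¬a≤⊥ : k ∧ □ (¬ a) ≤ ⊥
      k∧□¬a≤⊥ = begin
        k ∧ □ (¬ a)           ≤⟨ ∧-greatest x∧y≤x (open-∧-□-mono k-open (x≤y∨z⇒x∧¬y≤z k≤a∨b)) ⟩
        k ∧ □ b               ≤⟨ k∧□b≤⊥ ⟩
        ⊥                     ∎
        where open ≤-Reasoning

    □[[a∨b]∧[¬□a∧¬□b]]≤⊥ : ∀ a b → □ ((a ∨ b) ∧ (¬ □ a ∧ ¬ □ b)) ≤ ⊥
    □[[a∨b]∧[¬□a∧¬□b]]≤⊥ a b = begin
      k                       ≈⟨ k≤a∨b ⟨
      k ∧ (a ∨ b)             ≈⟨ ∧-distribˡ-∨ k a b ⟩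
      k ∧ a ∨ k ∧ b           ≤⟨ ∨-least k∧a≤⊥ k∧b≤⊥ ⟩
      ⊥                       ∎
      where
      open ≤-Reasoning
      y = (a ∨ b) ∧ (¬ □ a ∧ ¬ □ b)
      k = □ y

      k≤a∨b : k ≤ a ∨ b
      k≤a∨b = ≤-trans (□-defl y) x∧y≤x

      k∧□a≤⊥ : k ∧ □ a ≤ ⊥
      k∧□a≤⊥ = ≤-trans (∧-mono-≤ (≤-trans (□-defl y) (≤-trans x∧y≤y x∧y≤x)) ≤-refl)
                       (≤-reflexive (∧-complementˡ (□ a)))

      k∧□b≤⊥ : k ∧ □ b ≤ ⊥
      k∧□b≤⊥ = ≤-trans (∧-mono-≤ (≤-trans (□-defl y) (≤-trans x∧y≤y x∧y≤y)) ≤-refl)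
                       (≤-reflexive (∧-complementˡ (□ b)))

      k∧a≤⊥ : k ∧ a ≤ ⊥
      k∧a≤⊥ = open-≤-∨-disjoint-□⇒disjoint (□-idem y) k≤a∨b k∧□a≤⊥ k∧□b≤⊥

      k∧b≤⊥ : k ∧ b ≤ ⊥
      k∧b≤⊥ = open-≤-∨-disjoint-□⇒disjoint (□-idem y)
                (≤-trans k≤a∨b (≤-reflexive (∨-comm a b))) k∧□b≤⊥ k∧□a≤⊥

    □[a∨b]∧[□a∨□¬□a]∧[□b∨□¬□b]≤□a∨□b : ∀ a b →
      □ (a ∨ b) ∧ ((□ a ∨ □ (¬ □ a)) ∧ (□ b ∨ □ (¬ □ b))) ≤ □ a ∨ □ b
    □[a∨b]∧[□a∨□¬□a]∧[□b∨□¬□b]≤□a∨□b a b = x∧¬y≤⊥⇒x≤y (begin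
      A ∧ ¬ (□ a ∨ □ b)                       ≈⟨ ∧-congˡ (deMorgan₂ (□ a) (□ b)) ⟩
      A ∧ (¬ □ a ∧ ¬ □ b)                     ≤⟨ ∧-greatest (≤-trans x∧y≤x x∧y≤x) (∧-greatest ≤□¬□a ≤□¬□b) ⟩
      □ (a ∨ b) ∧ (□ (¬ □ a) ∧ □ (¬ □ b))     ≈⟨ ∧-congˡ (□-∧ (¬ □ a) (¬ □ b)) ⟨
      □ (a ∨ b) ∧ □ (¬ □ a ∧ ¬ □ b)           ≈⟨ □-∧ (a ∨ b) (¬ □ a ∧ ¬ □ b) ⟨
      □ ((a ∨ b) ∧ (¬ □ a ∧ ¬ □ b))           ≤⟨ □[[a∨b]∧[¬□a∧¬□b]]≤⊥ a b ⟩
      ⊥                                       ∎)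
      where
      open ≤-Reasoning
      A = □ (a ∨ b) ∧ ((□ a ∨ □ (¬ □ a)) ∧ (□ b ∨ □ (¬ □ b)))

      ≤□¬□a : A ∧ (¬ □ a ∧ ¬ □ b) ≤ □ (¬ □ a)
      ≤□¬□a = ≤-trans (∧-mono-≤ (≤-trans x∧y≤y x∧y≤x) x∧y≤x) [x∨y]∧¬x≤y

      ≤□¬□b : A ∧ (¬ □ a ∧ ¬ □ b) ≤ □ (¬ □ b)
      ≤□¬□b = ≤-trans (∧-mono-≤ (≤-trans x∧y≤y x∧y≤y) x∧y≤y) [x∨y]∧¬x≤y

-- Only the inclusion G(B) ⊆ Λ(B, ∇) and the ideal property of Δ are needed.
lemma3p2p4 : {c ℓ ℓ₁ ℓ₂ : Level} (B : TBA c ℓ)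
    (∇ : TBA.Carrier B → Set ℓ₁) (Δ : TBA.Carrier B → Set ℓ₂)
    → IsOpenFilter B ∇ → IsClosedIdeal B Δ
    → ModelsGrz B
    → (∀ a → IsOpenElt B a → InΛ B ∇ a)
    → (∀ a → InΛ B ∇ a → IsOpenElt B a)
    → ∀ a b → InTw B ∇ Δ a b → InTw B ∇ Δ (TBA.□ B a) (TBA.□ B b)
lemma3p2p4 B ∇ Δ ∇-open Δ-closed grz G⊆Λ _ a b (∇[a∨b] , Δ[a∧b]) = ∇[□a∨□b] , Δ[□a∧□b]
  where
  open TBA B hiding (_≤_)
  open BooleanAlgebraOrder BA
  open TopologicalBooleanAlgebraProperties B
  open Grzegorczyk grz
  open IsOpenFilter ∇-open using (box; isFilter)
  open IsFilter isFilter using (meet; upper)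
  open IsIdeal (IsClosedIdeal.isIdeal Δ-closed) using (lower)

  ∇[□x∨□¬□x] : ∀ x → ∇ (□ x ∨ □ (¬ □ x))
  ∇[□x∨□¬□x] x = proj₂ (G⊆Λ (□ x) (□-idem x))

  ∇[□a∨□b] : ∇ (□ a ∨ □ b)
  ∇[□a∨□b] = upper (meet (box ∇[a∨b]) (meet (∇[□x∨□¬□x] a) (∇[□x∨□¬□x] b)))
                   (□[a∨b]∧[□a∨□¬□a]∧[□b∨□¬□b]≤□a∨□b a b)

  Δ[□a∧□b] : Δ (□ a ∧ □ b)
  Δ[□a∧□b] = lower Δ[a∧b] (∧-mono-≤ (□-defl a) (□-defl b))
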